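{- Let $(B,A\cup\{\alpha\})$ be an admissible order-domain and $\mathsf{Match\_Ask}(B,A,\alpha)=(\hat B,\hat A,M)$. Then (a) $M$ is a matching over the order-domain $(B,A\cup\{\alpha\})$; (b) $\hat B=B-\mathsf{Bids}(M,B)$; (c) $\hat A=(A\cup\{\alpha\})-\mathsf{Asks}(M,A\cup\{\alpha\})$.
   Context: An order is a 4-tuple $\omega=(\mathsf{id}(\omega),\mathsf{timestamp}(\omega),\mathsf{qty}(\omega),\mathsf{price}(\omega))$ of natural numbers with $\mathsf{qty}(\omega)>0$. An order-domain $(B,A)$ is a pair of finite sets of orders (bids, asks); it is admissible if all orders in $B\cup A$ have pairwise distinct ids and pairwise distinct timestamps. Bid $b$ and ask $a$ are tradable if $\mathsf{price}(b)\ge\mathsf{price}(a)$. Bid $b_1$ is more competitive than $b_2$ iff $\mathsf{price}(b_1)>\mathsf{price}(b_2)$, or prices equal and $\mathsf{timestamp}(b_1)<\mathsf{timestamp}(b_2)$. A transaction is a triple $t=(\mathsf{id_{bid}}(t),\mathsf{id_{ask}}(t),\mathsf{qty}(t))$ with $\mathsf{qty}(t)>0$; it is valid w.r.t. $(B,A)$ if there are $b\in B,a\in A$ with matching ids, $b,a$ tradable, and $\mathsf{qty}(t)\le\min(\mathsf{qty}(b),\mathsf{qty}(a))$. $\mathsf{Qty}(M,id)$ is the total quantity of transactions in $M$ whose bid id (for a bid) resp. ask id (for an ask) is $id$. A matching over an admissible $(B,A)$ is a set $M$ of valid transactions with $\mathsf{Qty}(M,\mathsf{id}(\omega))\le\mathsf{qty}(\omega)$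 for all $\omega\in B\cup A$. $\mathsf{Bids}(M,B)$ is the set of bids in $B$ occurring in $M$ with quantity replaced by $\mathsf{Qty}(M,\mathsf{id}(b))$; $\mathsf{Asks}(M,A)$ likewise. Sets of orders are viewed as multisets where each order (quantity field suppressed) has multiplicity equal to its quantity; $S_1-S_2$ is multiset difference, $S_1\setminus S_2$ set difference. $\mathsf{Match\_Ask}(B,A,\alpha)$: if $B=\emptyset$ return $(B,A\cup\{\alpha\},\emptyset)$. Otherwise let $\beta$ be the most competitive bid in $B$. If $\beta,\alpha$ not tradable, return $(B,A\cup\{\alpha\},\emptyset)$. If $\mathsf{qty}(\beta)=\mathsf{qty}(\alpha)$, return $(B\setminus\{\beta\},A,\{(\mathsf{id}(\beta),\mathsf{id}(\alpha),\mathsf{qty}(\alpha))\})$. If $\mathsf{qty}(\beta)>\mathsf{qty}(\alpha)$, return $((B\setminus\{\beta\})\cup\{\beta'\},A,\{(\mathsf{id}(\beta),\mathsf{id}(\alpha),\mathsf{qty}(\alpha))\})$, where $\beta'$ equals $\beta$ except $\mathsf{qty}(\beta')=\mathsf{qty}(\beta)-\mathsf{qty}(\alpha)$. If $\mathsf{qty}(\beta)<\mathsf{qty}(\alpha)$, let $\alpha'$ equal $\alpha$ except $\mathsf{qty}(\alpha')=\mathsf{qty}(\alpha)-\mathsf{qty}(\beta)$, compute $(B'',A'',M'')=\mathsf{Match\_Ask}(B\setminus\{\beta\},A,\alpha')$ and return $(B'',A'',M''\cup\{(\mathsf{id}(\beta),\mathsf{id}(\alpha),\mathsf{qty}(\beta))\})$.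 -}

module Defs where

open import Data.Nat using (ℕ; zero; suc; _+_; _∸_; _≤_; _<_; _≥_; _>_; _≟_; _≤?_; _<?_)
open import Data.Nat.Properties using (<-cmp)
open import Data.Bool using (Bool; true; false; if_then_else_)
open import Data.List using (List; []; _∷_; filter; map; length)
open import Data.Nat.ListAction using (sum)
open import Data.List.Membership.Propositional using (_∈_)
open import Data.List.Relation.Unary.Any using (Any; any?)
open import Data.List.Relation.Unary.All using (All)
open import Data.List.Membership.DecPropositional using () renaming (_∈?_ to ∈?-dec)
open import Data.Product using (_×_; _,_; ∃; ∃-syntax; Σ)
open import Relation.Nullary using (Dec; yes; no; ¬_)
open import Relation.Nullary.Decidable using (_×-dec_; map′)
open import Relation.Binary using (Tri; tri<; tri≈; tri>; DecidableEquality)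
open import Relation.Binary.PropositionalEquality using (_≡_; refl; cong)

-- An order (id, timestamp, qty, price).  Positivity of qty is imposed
-- through admissibility of the order-domain (see Admissible below).
record Order : Set where
  constructor order
  field
    oid       : ℕ
    timestamp : ℕ
    qty       : ℕ
    price     : ℕ
open Order public

-- A transaction (id_bid, id_ask, qty); positivity of qty is part of
-- validity (ValidTx).
record Transaction : Set where
  constructor tx
  field
    idBid : ℕ
    idAsk : ℕ
    tqty  : ℕ
open Transaction public

_≟O_ : DecidableEquality Order
order i t q p ≟O order i' t' q' p' with i ≟ i' | t ≟ t' | q ≟ q' | p ≟ p'
... | yes refl | yes refl | yes refl | yes refl = yes refl
... | no ne | _ | _ | _ = no λ { refl → ne refl }
... | yes _ | no ne | _ | _ = no λ { refl → ne refl }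
... | yes _ | yes _ | no ne | _ = no λ { refl → ne refl }
... | yes _ | yes _ | yes _ | no ne = no λ { refl → ne refl }

_≟T_ : DecidableEquality Transaction
tx a b c ≟T tx a' b' c' with a ≟ a' | b ≟ b' | c ≟ c'
... | yes refl | yes refl | yes refl = yes refl
... | no ne | _ | _ = no λ { refl → ne refl }
... | yes _ | no ne | _ = no λ { refl → ne refl }
... | yes _ | yes _ | no ne = no λ { refl → ne refl }

-- Finite sets are represented by duplicate-free lists.
-- Set operations:

insertO : Order → List Order → List Order
insertO x S with ∈?-dec _≟O_ x S
... | yes _ = S
... | no  _ = x ∷ S

insertT : Transaction → List Transaction → List Transaction
insertT x S with ∈?-dec _≟T_ x S
... | yes _ = S
... | no  _ = x ∷ S

removeO : Order → List Order → List Order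
removeO x S = filter (λ o → Relation.Nullary.¬? (o ≟O x)) S
  where import Relation.Nullary

Admissible : List Order → List Order → Set
Admissible B A =
  (∀ {o} → o ∈ (B Data.List.++ A) → qty o > 0) ×
  (∀ {o₁ o₂} → o₁ ∈ (B Data.List.++ A) → o₂ ∈ (B Data.List.++ A) →
      oid o₁ ≡ oid o₂ → o₁ ≡ o₂) ×
  (∀ {o₁ o₂} → o₁ ∈ (B Data.List.++ A) → o₂ ∈ (B Data.List.++ A) →
      timestamp o₁ ≡ timestamp o₂ → o₁ ≡ o₂)

Tradable : Order → Order → Set
Tradable b a = price b ≥ price a

MoreCompetitive : Order → Order → Set
MoreCompetitive b₁ b₂ =
  (price b₁ > price b₂) Data.Sum.⊎ (price b₁ ≡ price b₂ × timestamp b₁ < timestamp b₂)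
  where import Data.Sum

moreCompetitive? : (b₁ b₂ : Order) → Dec (MoreCompetitive b₁ b₂)
moreCompetitive? b₁ b₂ =
  Relation.Nullary.Decidable._⊎-dec_ (price b₂ <? price b₁)
    ((price b₁ ≟ price b₂) ×-dec (timestamp b₁ <? timestamp b₂))

-- The most competitive order of the nonempty list x ∷ xs
-- (unique under admissibility, since timestamps are distinct).
best : Order → List Order → Order
best x [] = x
best x (y ∷ ys) with moreCompetitive? y (best x ys)
... | yes _ = y
... | no  _ = best x ys

QtyBid : List Transaction → ℕ → ℕ
QtyBid M i = sum (map tqty (filter (λ t → idBid t ≟ i) M))

QtyAsk : List Transaction → ℕ → ℕ
QtyAsk M i = sum (map tqty (filter (λ t → idAsk t ≟ i) M))

ValidTx : List Order → List Order → Transaction → Set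
ValidTx B A t =
  tqty t > 0 ×
  ∃[ b ] ∃[ a ] (b ∈ B × a ∈ A × oid b ≡ idBid t × oid a ≡ idAsk t ×
                 Tradable b a × tqty t ≤ qty b × tqty t ≤ qty a)

IsMatching : List Order → List Order → List Transaction → Set
IsMatching B A M =
  (∀ {t} → t ∈ M → ValidTx B A t) ×
  (∀ {b} → b ∈ B → QtyBid M (oid b) ≤ qty b) ×
  (∀ {a} → a ∈ A → QtyAsk M (oid a) ≤ qty a)

withQty : Order → ℕ → Order
withQty o q = order (oid o) (timestamp o) q (price o)

Bids : List Transaction → List Order → List Order
Bids M B =
  map (λ b → withQty b (QtyBid M (oid b)))
      (filter (λ b → any? (λ t → idBid t ≟ oid b) M) B)

Asks : List Transaction → List Order → List Order
Asks M A =
  map (λ a → withQty a (QtyAsk M (oid a)))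
      (filter (λ a → any? (λ t → idAsk t ≟ oid a) M) A)

-- Multiset view: each order (quantity suppressed, i.e. the key
-- (id, timestamp, price)) has multiplicity equal to its quantity.

mult : List Order → ℕ → ℕ → ℕ → ℕ
mult S i ts p =
  sum (map qty (filter (λ o → (oid o ≟ i) ×-dec ((timestamp o ≟ ts) ×-dec (price o ≟ p))) S))

_≡MS_-_ : List Order → List Order → List Order → Set
S₁ ≡MS S₂ - S₃ = ∀ i ts p → mult S₁ i ts p ≡ mult S₂ i ts p ∸ mult S₃ i ts p

Result : Set
Result = List Order × List Order × List Transaction

-- Auxiliary version with fuel n; the fuel is only used to make the
-- recursion structural.  Each recursive call removes β ∈ B from B, so
-- fuel = length B always suffices (the fuel-exhausted clause for a
-- nonempty B is never reached from matchAsk).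
matchAskF : ℕ → List Order → List Order → Order → Result
matchAskF _ [] A α = [] , insertO α A , []
matchAskF zero (b ∷ bs) A α = (b ∷ bs) , insertO α A , []
matchAskF (suc n) (b ∷ bs) A α = step (best b bs)
  where
  B = b ∷ bs
  step : Order → Result
  step β with price α ≤? price β
  ... | no _ = B , insertO α A , []
  ... | yes _ with <-cmp (qty β) (qty α)
  ...   | tri≈ _ _ _ = removeO β B , A , (tx (oid β) (oid α) (qty α) ∷ [])
  ...   | tri> _ _ _ =
          insertO (withQty β (qty β ∸ qty α)) (removeO β B) , A ,
          (tx (oid β) (oid α) (qty α) ∷ [])
  ...   | tri< _ _ _ with matchAskF n (removeO β B) A (withQty α (qty α ∸ qty β))
  ...     | B'' , A'' , M'' = B'' , A'' , insertT (tx (oid β) (oid α) (qty β)) M''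

Match-Ask : List Order → List Order → Order → Result
Match-Ask B A α = matchAskF (length B) B A α

-- Every trade of Match_Ask fills the incoming ask α against the current best bid β,
-- so a run is described by an invariant relative to α alone: the trades form a
-- matching over (B, {α}), the new bid book is B minus the traded bids, and the new
-- ask book is A plus the unfilled remainder of α. When β is used up, the recursive
-- call on B ∖ {β} and the reduced α satisfies the invariant, and prepending β's trade
-- restores it for B and α, because ids are distinct so no later trade touches β.
-- Multiset equalities are checked one key (id, timestamp, price) at a time, where an
-- order contributes either its quantity or nothing. Finally α's id is fresh in A,
-- so no resting ask is traded and the invariant yields the theorem.

module Submission where

open import Defs
open import Data.Bool using (true; false; if_then_else_)
open import Data.List using (List; []; _∷_; filter; map; length)
open import Data.Nat.ListAction using (sum)
open import Data.List.Membership.Propositional using (_∈_)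
open import Data.List.Membership.Propositional.Properties using (∈-filter⁻; ∈-filter⁺; ∈-++⁺ˡ; ∈-++⁺ʳ)
open import Data.List.Membership.DecPropositional using () renaming (_∈?_ to ∈?-dec)
open import Data.List.Properties using (filter-accept; filter-reject; filter-all; filter-notAll)
open import Data.List.Relation.Unary.All as All using ()
open import Data.List.Relation.Unary.Any as Any using (here; there; any?)
open import Data.List.Relation.Unary.Unique.Propositional using (Unique; _∷_)
open import Data.List.Relation.Unary.Unique.Propositional.Properties using (filter⁺)
open import Data.Nat using (ℕ; suc; _+_; _∸_; _≤_; _<_; _>_; _≟_; _≤?_; z≤n)
open import Data.Nat.Properties
open import Algebra.Properties.CommutativeSemigroup +-commutativeSemigroup using (x∙yz≈y∙xz)
open import Data.Empty using (⊥-elim)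
open import Function using (_∘_)
open import Data.Product using (_×_; _,_; proj₁; proj₂)
open import Relation.Binary using (tri<; tri≈; tri>)
open import Relation.Binary.PropositionalEquality
  using (_≡_; _≢_; refl; sym; trans; cong; cong₂; subst; module ≡-Reasoning)
open import Relation.Nullary using (¬_; Dec; does; yes; no; ¬?)
open import Relation.Nullary.Decidable using (_×-dec_)

∈-removeO⁻ : ∀ {β S o} → o ∈ removeO β S → o ∈ S × o ≢ β
∈-removeO⁻ {β} = ∈-filter⁻ (λ o → ¬? (o ≟O β))

removeO-⊆ : ∀ {β S o} → o ∈ removeO β S → o ∈ S
removeO-⊆ {β} {S} = proj₁ ∘ ∈-removeO⁻ {β} {S}

∈-removeO⁺ : ∀ {β S o} → o ∈ S → o ≢ β → o ∈ removeO β S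
∈-removeO⁺ {β} = ∈-filter⁺ (λ o → ¬? (o ≟O β))

removeO-∷-≢ : ∀ {β x} S → x ≢ β → removeO β (x ∷ S) ≡ x ∷ removeO β S
removeO-∷-≢ {β} S = filter-accept (λ o → ¬? (o ≟O β))

removeO-∷-fresh : ∀ {x S} → All.All (x ≢_) S → removeO x (x ∷ S) ≡ S
removeO-∷-fresh {x} x∉S =
  trans (filter-reject (λ o → ¬? (o ≟O x)) (λ x≢x → x≢x refl))
        (filter-all (λ o → ¬? (o ≟O x)) (All.map (λ x≢o o≡x → x≢o (sym o≡x)) x∉S))

removeO-unique : ∀ {β S} → Unique S → Unique (removeO β S)
removeO-unique {β} = filter⁺ (λ o → ¬? (o ≟O β))

length-removeO : ∀ {β} S → β ∈ S → length (removeO β S) < length S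
length-removeO {β} S β∈S = filter-notAll (λ o → ¬? (o ≟O β)) S (Any.map (λ β≡o o≢β → o≢β (sym β≡o)) β∈S)

module _ (i ts p : ℕ) where

  hasKey? : (o : Order) → Dec (oid o ≡ i × timestamp o ≡ ts × price o ≡ p)
  hasKey? o = (oid o ≟ i) ×-dec ((timestamp o ≟ ts) ×-dec (price o ≟ p))

  weight : Order → ℕ → ℕ
  weight o q = if does (hasKey? o) then q else 0

  weight-0 : ∀ o → weight o 0 ≡ 0
  weight-0 o with does (hasKey? o)
  ... | true  = refl
  ... | false = refl

  weight-∸ : ∀ o m n → weight o (m ∸ n) ≡ weight o m ∸ weight o n
  weight-∸ o m n with does (hasKey? o)
  ... | true  = refl
  ... | false = refl

  weight-mono : ∀ o {m n} → m ≤ n → weight o m ≤ weight o n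
  weight-mono o m≤n with does (hasKey? o)
  ... | true  = m≤n
  ... | false = z≤n

  mult-∷ : ∀ o S → mult (o ∷ S) i ts p ≡ weight o (qty o) + mult S i ts p
  mult-∷ o S with does (hasKey? o)
  ... | true  = refl
  ... | false = refl

  mult-∷-0 : ∀ o S → mult (withQty o 0 ∷ S) i ts p ≡ mult S i ts p
  mult-∷-0 o S = trans (mult-∷ (withQty o 0) S) (cong (_+ mult S i ts p) (weight-0 o))

  weightedSum : (Order → ℕ) → List Order → ℕ
  weightedSum f []      = 0
  weightedSum f (o ∷ S) = weight o (f o) + weightedSum f S

  mult≡weightedSum-qty : ∀ S → mult S i ts p ≡ weightedSum qty S
  mult≡weightedSum-qty []      = refl
  mult≡weightedSum-qty (o ∷ S) = trans (mult-∷ o S) (cong (weight o (qty o) +_) (mult≡weightedSum-qty S))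

  weightedSum-cong : ∀ {f g} S → (∀ {o} → o ∈ S → f o ≡ g o) → weightedSum f S ≡ weightedSum g S
  weightedSum-cong []      f≗g = refl
  weightedSum-cong (o ∷ S) f≗g =
    cong₂ _+_ (cong (weight o) (f≗g (here refl))) (weightedSum-cong S (λ o∈S → f≗g (there o∈S)))

  weightedSum-zero : ∀ {f} S → (∀ {o} → o ∈ S → f o ≡ 0) → weightedSum f S ≡ 0
  weightedSum-zero []      f≗0 = refl
  weightedSum-zero (o ∷ S) f≗0 =
    cong₂ _+_ (trans (cong (weight o) (f≗0 (here refl))) (weight-0 o))
              (weightedSum-zero S (λ o∈S → f≗0 (there o∈S)))

  weightedSum-removeO : ∀ f {β} S → Unique S → β ∈ S →
                        weightedSum f S ≡ weight β (f β) + weightedSum f (removeO β S)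
  weightedSum-removeO f (x ∷ S) (x∉S ∷ _) (here refl) =
    cong (λ R → weight x (f x) + weightedSum f R) (sym (removeO-∷-fresh x∉S))
  weightedSum-removeO f {β} (x ∷ S) (x∉S ∷ uS) (there β∈S) = begin
    weight x (f x) + weightedSum f S
      ≡⟨ cong (weight x (f x) +_) (weightedSum-removeO f S uS β∈S) ⟩
    weight x (f x) + (weight β (f β) + weightedSum f (removeO β S))
      ≡⟨ x∙yz≈y∙xz (weight x (f x)) (weight β (f β)) _ ⟩
    weight β (f β) + (weight x (f x) + weightedSum f (removeO β S))
      ≡⟨ cong (λ R → weight β (f β) + weightedSum f R) (sym (removeO-∷-≢ S (All.lookup x∉S β∈S))) ⟩
    weight β (f β) + weightedSum f (removeO β (x ∷ S))
      ∎
    where open ≡-Reasoning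

  mult-removeO : ∀ {β} S → Unique S → β ∈ S → mult S i ts p ≡ mult (β ∷ removeO β S) i ts p
  mult-removeO {β} S uS β∈S = begin
    mult S i ts p                                   ≡⟨ mult≡weightedSum-qty S ⟩
    weightedSum qty S                               ≡⟨ weightedSum-removeO qty S uS β∈S ⟩
    weight β (qty β) + weightedSum qty (removeO β S) ≡⟨ cong (weight β (qty β) +_) (sym (mult≡weightedSum-qty (removeO β S))) ⟩
    weight β (qty β) + mult (removeO β S) i ts p    ≡⟨ sym (mult-∷ β (removeO β S)) ⟩
    mult (β ∷ removeO β S) i ts p                   ∎
    where open ≡-Reasoning

  mult-∷-∸ : ∀ o {q} S → q ≤ qty o →
             mult (withQty o (qty o ∸ q) ∷ S) i ts p ≡ mult (o ∷ S) i ts p ∸ weight o q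
  mult-∷-∸ o {q} S q≤qty = begin
    mult (withQty o (qty o ∸ q) ∷ S) i ts p        ≡⟨ mult-∷ (withQty o (qty o ∸ q)) S ⟩
    weight o (qty o ∸ q) + mult S i ts p           ≡⟨ cong (_+ mult S i ts p) (weight-∸ o (qty o) q) ⟩
    (weight o (qty o) ∸ weight o q) + mult S i ts p ≡⟨ sym (+-∸-comm (mult S i ts p) (weight-mono o q≤qty)) ⟩
    (weight o (qty o) + mult S i ts p) ∸ weight o q ≡⟨ cong (_∸ weight o q) (sym (mult-∷ o S)) ⟩
    mult (o ∷ S) i ts p ∸ weight o q               ∎
    where open ≡-Reasoning

-- QtyOf idBid, traded idBid are definitionally QtyBid, Bids (and likewise for asks).
QtyOf : (Transaction → ℕ) → List Transaction → ℕ → ℕ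
QtyOf side M j = sum (map tqty (filter (λ t → side t ≟ j) M))

traded : (Transaction → ℕ) → List Transaction → List Order → List Order
traded side M S =
  map (λ o → withQty o (QtyOf side M (oid o))) (filter (λ o → any? (λ t → side t ≟ oid o) M) S)

Untraded : (Transaction → ℕ) → ℕ → List Transaction → Set
Untraded side j M = ∀ {t} → t ∈ M → side t ≢ j

QtyOf-∷-hit : ∀ side {t j} M → side t ≡ j → QtyOf side (t ∷ M) j ≡ tqty t + QtyOf side M j
QtyOf-∷-hit side {j = j} M = cong (λ T → sum (map tqty T)) ∘ filter-accept (λ t → side t ≟ j)

QtyOf-∷-miss : ∀ side {t j} M → side t ≢ j → QtyOf side (t ∷ M) j ≡ QtyOf side M j
QtyOf-∷-miss side {j = j} M = cong (λ T → sum (map tqty T)) ∘ filter-reject (λ t → side t ≟ j)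

QtyOf-untraded : ∀ side {j} M → Untraded side j M → QtyOf side M j ≡ 0
QtyOf-untraded side []      _        = refl
QtyOf-untraded side (t ∷ M) untraded =
  trans (QtyOf-∷-miss side M (untraded (here refl))) (QtyOf-untraded side M (λ t∈M → untraded (there t∈M)))

QtyOf-single : ∀ side {t j} M → side t ≡ j → Untraded side j M → QtyOf side (t ∷ M) j ≡ tqty t
QtyOf-single side {t} M hit untraded =
  trans (QtyOf-∷-hit side M hit) (trans (cong (tqty t +_) (QtyOf-untraded side M untraded)) (+-identityʳ (tqty t)))

mult-traded : ∀ i ts p side M S → mult (traded side M S) i ts p ≡ weightedSum i ts p (λ o → QtyOf side M (oid o)) S
mult-traded i ts p side M []      = refl
mult-traded i ts p side M (o ∷ S) with any? (λ t → side t ≟ oid o) M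
... | yes _ = trans (mult-∷ i ts p (withQty o (QtyOf side M (oid o))) (traded side M S))
                    (cong (weight i ts p o (QtyOf side M (oid o)) +_) (mult-traded i ts p side M S))
... | no none = begin
  mult (traded side M S) i ts p
    ≡⟨ mult-traded i ts p side M S ⟩
  weightedSum i ts p (λ o → QtyOf side M (oid o)) S
    ≡⟨ cong (_+ weightedSum i ts p _ S) (sym zero-weight) ⟩
  weight i ts p o (QtyOf side M (oid o)) + weightedSum i ts p (λ o → QtyOf side M (oid o)) S
    ∎
  where
  open ≡-Reasoning
  zero-weight : weight i ts p o (QtyOf side M (oid o)) ≡ 0
  zero-weight = trans (cong (weight i ts p o) (QtyOf-untraded side M (λ t∈M hit → none (Any.map (λ { refl → hit }) t∈M))))
                      (weight-0 i ts p o)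

Bids-[] : ∀ B → Bids [] B ≡ []
Bids-[] []      = refl
Bids-[] (_ ∷ B) = Bids-[] B

insertO-∉ : ∀ {x S} → ¬ x ∈ S → insertO x S ≡ x ∷ S
insertO-∉ {x} {S} x∉S with ∈?-dec _≟O_ x S
... | yes x∈S = ⊥-elim (x∉S x∈S)
... | no  _   = refl

insertT-∉ : ∀ {x S} → ¬ x ∈ S → insertT x S ≡ x ∷ S
insertT-∉ {x} {S} x∉S with ∈?-dec _≟T_ x S
... | yes x∈S = ⊥-elim (x∉S x∈S)
... | no  _   = refl

best-∈ : ∀ x xs → best x xs ∈ x ∷ xs
best-∈ x []       = here refl
best-∈ x (y ∷ ys) with moreCompetitive? y (best x ys)
... | yes _ = there (here refl)
... | no  _ = skip-y (best-∈ x ys)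
  where
  skip-y : ∀ {o} → o ∈ x ∷ ys → o ∈ x ∷ y ∷ ys
  skip-y (here o≡x)   = here o≡x
  skip-y (there o∈ys) = there (there o∈ys)

record WellFormedBook (B : List Order) : Set where
  field
    unique        : Unique B
    oid-injective : ∀ {b₁ b₂} → b₁ ∈ B → b₂ ∈ B → oid b₁ ≡ oid b₂ → b₁ ≡ b₂
    qty-positive  : ∀ {b} → b ∈ B → qty b > 0

open WellFormedBook

removeO-wellFormed : ∀ {β B} → WellFormedBook B → WellFormedBook (removeO β B)
removeO-wellFormed wf = record
  { unique        = removeO-unique (unique wf)
  ; oid-injective = λ b₁∈ b₂∈ → oid-injective wf (removeO-⊆ b₁∈) (removeO-⊆ b₂∈)
  ; qty-positive  = qty-positive wf ∘ removeO-⊆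
  }

ValidTx-idAsk : ∀ {B α t} → ValidTx B (α ∷ []) t → idAsk t ≡ oid α
ValidTx-idAsk (_ , _ , _ , _ , here refl , _ , a≡ , _) = sym a≡

ValidTx-enlarge : ∀ {R B α q t} → (∀ {b} → b ∈ R → b ∈ B) → q ≤ qty α →
                  ValidTx R (withQty α q ∷ []) t → ValidTx B (α ∷ []) t
ValidTx-enlarge R⊆B q≤qty (pos , b , _ , b∈R , here refl , b≡ , a≡ , trad , t≤b , t≤q) =
  pos , b , _ , R⊆B b∈R , here refl , b≡ , a≡ , trad , t≤b , ≤-trans t≤q q≤qty

untraded-removeO : ∀ {β B A M} → WellFormedBook B → β ∈ B →
                   (∀ {t} → t ∈ M → ValidTx (removeO β B) A t) → Untraded idBid (oid β) M
untraded-removeO {β} {B} wf β∈B valid t∈M hit with valid t∈M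
... | _ , b , _ , b∈R , _ , b≡ , _ with ∈-removeO⁻ {β} {B} b∈R
...   | b∈B , b≢β = b≢β (oid-injective wf b∈B β∈B (trans b≡ hit))

QtyBid-fill-bound : ∀ {β B M j q} → WellFormedBook B → β ∈ B → q ≤ qty β → Untraded idBid (oid β) M →
                    (∀ {b} → b ∈ removeO β B → QtyBid M (oid b) ≤ qty b) →
                    ∀ {b} → b ∈ B → QtyBid (tx (oid β) j q ∷ M) (oid b) ≤ qty b
QtyBid-fill-bound {β} {B} {M} wf β∈B q≤qty untraded bound {b} b∈B with oid β ≟ oid b
... | yes same with oid-injective wf β∈B b∈B same
...   | refl = ≤-trans (≤-reflexive (QtyOf-single idBid M refl untraded)) q≤qty
QtyBid-fill-bound {β} {B} {M} wf β∈B q≤qty untraded bound {b} b∈B | no differ =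
  ≤-trans (≤-reflexive (QtyOf-∷-miss idBid M differ))
          (bound (∈-removeO⁺ b∈B (λ b≡β → differ (cong oid (sym b≡β)))))

mult-Bids-fill : ∀ i ts p {β B M j q} → WellFormedBook B → β ∈ B → Untraded idBid (oid β) M →
                 mult (Bids (tx (oid β) j q ∷ M) B) i ts p ≡ weight i ts p β q + mult (Bids M (removeO β B)) i ts p
mult-Bids-fill i ts p {β} {B} {M} {j} {q} wf β∈B untraded = begin
  mult (Bids (t ∷ M) B) i ts p
    ≡⟨ mult-traded i ts p idBid (t ∷ M) B ⟩
  weightedSum i ts p (λ b → QtyBid (t ∷ M) (oid b)) B
    ≡⟨ weightedSum-removeO i ts p _ B (unique wf) β∈B ⟩
  weight i ts p β (QtyBid (t ∷ M) (oid β)) + weightedSum i ts p (λ b → QtyBid (t ∷ M) (oid b)) (removeO β B)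
    ≡⟨ cong₂ _+_ (cong (weight i ts p β) (QtyOf-single idBid M refl untraded))
                 (weightedSum-cong i ts p (removeO β B) others-unchanged) ⟩
  weight i ts p β q + weightedSum i ts p (λ b → QtyBid M (oid b)) (removeO β B)
    ≡⟨ cong (weight i ts p β q +_) (sym (mult-traded i ts p idBid M (removeO β B))) ⟩
  weight i ts p β q + mult (Bids M (removeO β B)) i ts p
    ∎
  where
  open ≡-Reasoning
  t : Transaction
  t = tx (oid β) j q
  others-unchanged : ∀ {b} → b ∈ removeO β B → QtyBid (t ∷ M) (oid b) ≡ QtyBid M (oid b)
  others-unchanged {b} b∈R with ∈-removeO⁻ {β} {B} b∈R
  ... | b∈B , b≢β = QtyOf-∷-miss idBid M (λ same → b≢β (sym (oid-injective wf β∈B b∈B same)))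

-- Relative to the single ask α, whose unfilled remainder joins the resting asks A:
-- this form survives partially filling α before the recursive call.
record Sound (B A : List Order) (α : Order) (B̂ Â : List Order) (M : List Transaction) : Set where
  constructor sound
  field
    matching : IsMatching B (α ∷ []) M
    bidsLeft : B̂ ≡MS B - Bids M B
    asksLeft : ∀ i ts p → mult Â i ts p ≡ mult (withQty α (qty α ∸ QtyAsk M (oid α)) ∷ A) i ts p

SoundResult : List Order → List Order → Order → Result → Set
SoundResult B A α (B̂ , Â , M) = Sound B A α B̂ Â M

sound-noTrade : ∀ {B A α} → (∀ {a} → a ∈ A → oid a ≢ oid α) → Sound B A α B (insertO α A) []
sound-noTrade {B} {A} {α} fresh = record
  { matching = (λ ()) , (λ _ → z≤n) , (λ _ → z≤n)
  ; bidsLeft = λ i ts p → cong (λ S → mult B i ts p ∸ mult S i ts p) (sym (Bids-[] B))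
  ; asksLeft = λ i ts p → cong (λ S → mult S i ts p) (insertO-∉ (λ α∈A → fresh α∈A refl))
  }

sound-fillAsk : ∀ {B A α β B̂} → WellFormedBook B → β ∈ B → Tradable β α → qty α > 0 → qty α ≤ qty β →
                (∀ i ts p → mult B̂ i ts p ≡ mult (withQty β (qty β ∸ qty α) ∷ removeO β B) i ts p) →
                Sound B A α B̂ A (tx (oid β) (oid α) (qty α) ∷ [])
sound-fillAsk {B} {A} {α} {β} {B̂} wf β∈B tradable qα>0 qα≤qβ B̂-remainder = record
  { matching = valid , QtyBid-fill-bound wf β∈B qα≤qβ (λ ()) (λ _ → z≤n) , askBound
  ; bidsLeft = bidsLeft
  ; asksLeft = λ i ts p → sym (trans (cong (λ q → mult (withQty α q ∷ A) i ts p) filled) (mult-∷-0 i ts p α A))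
  }
  where
  t : Transaction
  t = tx (oid β) (oid α) (qty α)
  askTraded : QtyAsk (t ∷ []) (oid α) ≡ qty α
  askTraded = QtyOf-single idAsk {t} {oid α} [] refl (λ ())
  filled : qty α ∸ QtyAsk (t ∷ []) (oid α) ≡ 0
  filled = trans (cong (qty α ∸_) askTraded) (n∸n≡0 (qty α))
  valid : ∀ {t′} → t′ ∈ t ∷ [] → ValidTx B (α ∷ []) t′
  valid (here refl) = qα>0 , β , α , β∈B , here refl , refl , refl , tradable , qα≤qβ , ≤-refl
  askBound : ∀ {a} → a ∈ α ∷ [] → QtyAsk (t ∷ []) (oid a) ≤ qty a
  askBound (here refl) = ≤-reflexive askTraded
  bidsLeft : B̂ ≡MS B - Bids (t ∷ []) B
  bidsLeft i ts p = begin
    mult B̂ i ts p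
      ≡⟨ B̂-remainder i ts p ⟩
    mult (withQty β (qty β ∸ qty α) ∷ removeO β B) i ts p
      ≡⟨ mult-∷-∸ i ts p β (removeO β B) qα≤qβ ⟩
    mult (β ∷ removeO β B) i ts p ∸ weight i ts p β (qty α)
      ≡⟨ cong₂ _∸_ (sym (mult-removeO i ts p B (unique wf) β∈B)) (sym nothingElseTraded) ⟩
    mult B i ts p ∸ (weight i ts p β (qty α) + mult (Bids [] (removeO β B)) i ts p)
      ≡⟨ cong (mult B i ts p ∸_) (sym (mult-Bids-fill i ts p wf β∈B (λ ()))) ⟩
    mult B i ts p ∸ mult (Bids (t ∷ []) B) i ts p
      ∎
    where
    open ≡-Reasoning
    nothingElseTraded : weight i ts p β (qty α) + mult (Bids [] (removeO β B)) i ts p ≡ weight i ts p β (qty α)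
    nothingElseTraded = trans (cong (λ S → weight i ts p β (qty α) + mult S i ts p) (Bids-[] (removeO β B)))
                              (+-identityʳ (weight i ts p β (qty α)))

sound-fillBid : ∀ {B A α β B̂ Â M} → WellFormedBook B → β ∈ B → Tradable β α → qty β < qty α →
                Sound (removeO β B) A (withQty α (qty α ∸ qty β)) B̂ Â M →
                Sound B A α B̂ Â (insertT (tx (oid β) (oid α) (qty β)) M)
sound-fillBid {B} {A} {α} {β} {B̂} {Â} {M} wf β∈B tradable qβ<qα
              (sound (valid″ , bidBound″ , askBound″) bidsLeft″ asksLeft″) =
  subst (Sound B A α B̂ Â) (sym (insertT-∉ (λ t∈M → untraded t∈M refl))) (record
    { matching = valid , QtyBid-fill-bound wf β∈B ≤-refl untraded bidBound″ , askBound
    ; bidsLeft = bidsLeft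
    ; asksLeft = λ i ts p → trans (asksLeft″ i ts p) (cong (λ q → mult (withQty α q ∷ A) i ts p) remainder)
    })
  where
  t : Transaction
  t = tx (oid β) (oid α) (qty β)
  R : List Order
  R = removeO β B
  untraded : Untraded idBid (oid β) M
  untraded = untraded-removeO wf β∈B valid″
  askTraded : QtyAsk (t ∷ M) (oid α) ≡ qty β + QtyAsk M (oid α)
  askTraded = QtyOf-∷-hit idAsk M refl
  remainder : qty α ∸ qty β ∸ QtyAsk M (oid α) ≡ qty α ∸ QtyAsk (t ∷ M) (oid α)
  remainder = trans (∸-+-assoc (qty α) (qty β) _) (cong (qty α ∸_) (sym askTraded))
  valid : ∀ {t′} → t′ ∈ t ∷ M → ValidTx B (α ∷ []) t′
  valid (here refl)  = qty-positive wf β∈B , β , α , β∈B , here refl , refl , refl , tradable , ≤-refl , <⇒≤ qβ<qα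
  valid (there t′∈M) = ValidTx-enlarge removeO-⊆ (m∸n≤m (qty α) (qty β)) (valid″ t′∈M)
  askBound : ∀ {a} → a ∈ α ∷ [] → QtyAsk (t ∷ M) (oid a) ≤ qty a
  askBound (here refl) = begin
    QtyAsk (t ∷ M) (oid α)       ≡⟨ askTraded ⟩
    qty β + QtyAsk M (oid α)     ≤⟨ +-monoʳ-≤ (qty β) (askBound″ (here refl)) ⟩
    qty β + (qty α ∸ qty β)      ≡⟨ m+[n∸m]≡n (<⇒≤ qβ<qα) ⟩
    qty α                        ∎
    where open ≤-Reasoning
  bidsLeft : B̂ ≡MS B - Bids (t ∷ M) B
  bidsLeft i ts p = begin
    mult B̂ i ts p
      ≡⟨ bidsLeft″ i ts p ⟩
    mult R i ts p ∸ mult (Bids M R) i ts p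
      ≡⟨ sym ([m+n]∸[m+o]≡n∸o (weight i ts p β (qty β)) _ _) ⟩
    (weight i ts p β (qty β) + mult R i ts p) ∸ (weight i ts p β (qty β) + mult (Bids M R) i ts p)
      ≡⟨ cong₂ _∸_ (sym (trans (mult-removeO i ts p B (unique wf) β∈B) (mult-∷ i ts p β R)))
                   (sym (mult-Bids-fill i ts p wf β∈B untraded)) ⟩
    mult B i ts p ∸ mult (Bids (t ∷ M) B) i ts p
      ∎
    where open ≡-Reasoning

sound-matchAskF : ∀ n {B A α} → length B ≤ n → WellFormedBook B → qty α > 0 →
                  (∀ {a} → a ∈ A → oid a ≢ oid α) → SoundResult B A α (matchAskF n B A α)
sound-matchAskF n       {[]}     _  _  _    fresh = sound-noTrade fresh
sound-matchAskF (suc n) {b ∷ bs} {A} {α} len wf qα>0 fresh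
  with best b bs | best-∈ b bs
... | β | β∈B with price α ≤? price β
...   | no _ = sound-noTrade fresh
...   | yes tradable with <-cmp (qty β) (qty α)
...     | tri≈ _ qβ≡qα _ = sound-fillAsk wf β∈B tradable qα>0 (≤-reflexive (sym qβ≡qα)) fullyFilled
      where
      fullyFilled : ∀ i ts p → mult (removeO β (b ∷ bs)) i ts p
                             ≡ mult (withQty β (qty β ∸ qty α) ∷ removeO β (b ∷ bs)) i ts p
      fullyFilled i ts p = sym (trans (cong (λ q → mult (withQty β q ∷ removeO β (b ∷ bs)) i ts p)
                                            (trans (cong (_∸ qty α) qβ≡qα) (n∸n≡0 (qty α))))
                                      (mult-∷-0 i ts p β (removeO β (b ∷ bs))))
...     | tri> _ _ qβ>qα = sound-fillAsk wf β∈B tradable qα>0 (<⇒≤ qβ>qα)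
                             (λ i ts p → cong (λ S → mult S i ts p) (insertO-∉ remainder∉R))
      where
      remainder∉R : ¬ withQty β (qty β ∸ qty α) ∈ removeO β (b ∷ bs)
      remainder∉R β′∈R with ∈-removeO⁻ {β} {b ∷ bs} β′∈R
      ... | β′∈B , β′≢β = β′≢β (oid-injective wf β′∈B β∈B refl)
...     | tri< qβ<qα _ _
  with matchAskF n (removeO β (b ∷ bs)) A (withQty α (qty α ∸ qty β))
     | sound-matchAskF n {removeO β (b ∷ bs)} {A} {withQty α (qty α ∸ qty β)}
         (≤-pred (≤-trans (length-removeO (b ∷ bs) β∈B) len)) (removeO-wellFormed wf) (m<n⇒0<n∸m qβ<qα) fresh
...       | B″ , A″ , M″ | inner = sound-fillBid wf β∈B tradable qβ<qα inner

sound⇒IsMatching×residuals : ∀ {B A α B̂ Â M} → (∀ {a} → a ∈ A → oid a ≢ oid α) → Sound B A α B̂ Â M →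
                             IsMatching B (α ∷ A) M × (B̂ ≡MS B - Bids M B) × (Â ≡MS (α ∷ A) - Asks M (α ∷ A))
sound⇒IsMatching×residuals {B} {A} {α} {B̂} {Â} {M} fresh
  (sound (valid₁ , bidBound , askBound₁) bidsLeft asksLeft) =
  (valid , bidBound , askBound) , bidsLeft , asksLeft′
  where
  αBound : QtyAsk M (oid α) ≤ qty α
  αBound = askBound₁ (here refl)
  restingUntraded : ∀ {a} → a ∈ A → QtyAsk M (oid a) ≡ 0
  restingUntraded a∈A = QtyOf-untraded idAsk M (λ t∈M hit → fresh a∈A (trans (sym hit) (ValidTx-idAsk (valid₁ t∈M))))
  valid : ∀ {t} → t ∈ M → ValidTx B (α ∷ A) t
  valid t∈M with valid₁ t∈M
  ... | pos , b , _ , b∈B , here refl , rest = pos , b , α , b∈B , here refl , rest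
  askBound : ∀ {a} → a ∈ α ∷ A → QtyAsk M (oid a) ≤ qty a
  askBound (here refl) = αBound
  askBound (there a∈A) = ≤-trans (≤-reflexive (restingUntraded a∈A)) z≤n
  asksLeft′ : Â ≡MS (α ∷ A) - Asks M (α ∷ A)
  asksLeft′ i ts p = begin
    mult Â i ts p
      ≡⟨ asksLeft i ts p ⟩
    mult (withQty α (qty α ∸ QtyAsk M (oid α)) ∷ A) i ts p
      ≡⟨ mult-∷-∸ i ts p α A αBound ⟩
    mult (α ∷ A) i ts p ∸ weight i ts p α (QtyAsk M (oid α))
      ≡⟨ cong (mult (α ∷ A) i ts p ∸_) (sym asked) ⟩
    mult (α ∷ A) i ts p ∸ mult (Asks M (α ∷ A)) i ts p
      ∎
    where
    open ≡-Reasoning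
    asked : mult (Asks M (α ∷ A)) i ts p ≡ weight i ts p α (QtyAsk M (oid α))
    asked = trans (mult-traded i ts p idAsk M (α ∷ A))
                  (trans (cong (weight i ts p α (QtyAsk M (oid α)) +_) (weightedSum-zero i ts p A restingUntraded))
                         (+-identityʳ _))

admissible⇒wellFormed : ∀ {B A} → Unique B → Admissible B A → WellFormedBook B
admissible⇒wellFormed uniqueB (positive , oid-inj , _) = record
  { unique        = uniqueB
  ; oid-injective = λ b₁∈B b₂∈B → oid-inj (∈-++⁺ˡ b₁∈B) (∈-++⁺ˡ b₂∈B)
  ; qty-positive  = positive ∘ ∈-++⁺ˡ
  }

admissible-fresh : ∀ {B A α} → ¬ α ∈ A → Admissible B (α ∷ A) → ∀ {a} → a ∈ A → oid a ≢ oid α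
admissible-fresh {B} α∉A (_ , oid-inj , _) a∈A same with oid-inj (∈-++⁺ʳ B (there a∈A)) (∈-++⁺ʳ B (here refl)) same
... | refl = α∉A a∈A

lemmaA3 : (B A : List Order) (α : Order) →
          Unique B → Unique A → ¬ (α ∈ A) →
          Admissible B (insertO α A) →
          (B̂ Â : List Order) (M : List Transaction) →
          Match-Ask B A α ≡ (B̂ , Â , M) →
          IsMatching B (insertO α A) M ×
          (B̂ ≡MS B - Bids M B) ×
          (Â ≡MS insertO α A - Asks M (insertO α A))
lemmaA3 B A α uniqueB _ α∉A admissible B̂ Â M run =
  subst (λ A′ → IsMatching B A′ M × (B̂ ≡MS B - Bids M B) × (Â ≡MS A′ - Asks M A′)) (sym (insertO-∉ α∉A))
    (sound⇒IsMatching×residuals fresh (subst (SoundResult B A α) run sound-run))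
  where
  admissible′ : Admissible B (α ∷ A)
  admissible′ = subst (Admissible B) (insertO-∉ α∉A) admissible
  fresh : ∀ {a} → a ∈ A → oid a ≢ oid α
  fresh = admissible-fresh α∉A admissible′
  sound-run : SoundResult B A α (Match-Ask B A α)
  sound-run = sound-matchAskF (length B) ≤-refl (admissible⇒wellFormed uniqueB admissible′)
                (proj₁ admissible′ (∈-++⁺ʳ B (here refl))) fresh
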